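{- Let $\mathcal{G}$ be a temporal graph with lifetime $T$, let $c$ be a positive integer, and let $(H,\mathcal{D})$ be a nice tree decomposition of its underlying graph. Let $b$ be a forget node with child $b'$ such that $\mathcal{D}(b)=\mathcal{D}(b')\setminus\{v\}$ for some $v \in \mathcal{D}(b')$. Then a state $(\pi,\alpha,\beta,\gamma)$ is valid for $b$ if and only if there exists a valid state $(\pi',\alpha',\beta',\gamma')$ of $b'$ such that: (1) $\pi=\pi'|_{\mathcal{D}(b)\times [T]}$; (2) for all $p\in[c]$, $\alpha(p) =\alpha'(p) +|\{(u,t): t\in[T],\ u\in \mathcal{D}(b),\ uv \in E_t,\ \pi'(u,t)=\pi'(v,t)=p\}|$; (3) for all $p\in[c]$, $t\in[T]$, $\beta(p,t)=\beta'(p,t) + d_{v,t}$ if $\pi'(v,t)=p$ and $\beta(p,t)=\beta'(p,t)$ otherwise; and (4) $\gamma = \gamma' + |\{t \in [T-1]:\pi'(v,t)=\pi'(v,t+1)\}|$.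
   Context: A temporal graph $\mathcal{G}=(G,\lambda)$ with lifetime $T$: $G=(V,E)$ simple undirected (the underlying graph), $\lambda:E\to2^{[T]}$, snapshots $G_t=(V,E_t)$ with $E_t=\{e:t\in\lambda(e)\}$, $d_{u,t}$ the degree of $u$ in $G_t$; $m=|E|$, $n=|V|$. A tree decomposition $(H,\mathcal{D})$ of $G$ is a tree $H$ with bags $\mathcal{D}(b)\subseteq V$ ($b\in V(H)$) such that every vertex is in some bag, every edge has both ends in some bag, and for each vertex the nodes whose bags contain it induce a connected subtree. It is nice if $H$ is rooted, all leaves and the root have empty bags, and every non-leaf node is an introduce node (one child $b'$, $\mathcal{D}(b)=\mathcal{D}(b')\cup\{v\}$ with $v\notin\mathcal{D}(b')$), a forget node (one child $b'$, $\mathcal{D}(b)=\mathcal{D}(b')\setminus\{v\}$ with $v\in\mathcal{D}(b')$), or a join node (two children $b_1,b_2$ with $\mathcal{D}(b)=\mathcal{D}(b_1)=\mathcal{D}(b_2)$). $V_b$ is the union of $\mathcal{D}(b)$ and all bags of nodes below $b$; $V_b\setminus\mathcal{D}(b)$ is the set of vertices forgotten at $b$. A state of $b$ is a tuple $(\pi,\alpha,\beta,\gamma)$ with $\pi:\mathcal{D}(b)\times[T]\to[c]$, $\alpha:[c]\to\{0,\dots,mT\}$, $\beta:[c]\times[T]\to\{0,\dots,2m\}$, and an integer $\gamma$. It is valid if there is a function $\pi^*:V_b\times[T]\to[c]$ (said to support it) with $\pi^*|_{\mathcal{D}(b)\times[T]}=\pi$; $\alpha(p)=|\{(uv,t): t\in[T],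 uv\in E_t, \pi^*(u,t)=\pi^*(v,t)=p, \{u,v\}\cap(V_b\setminus\mathcal{D}(b))\ne\emptyset\}|$ for each $p\in[c]$; $\beta(p,t)=\sum_{u\in V_b\setminus\mathcal{D}(b),\,\pi^*(u,t)=p}d_{u,t}$ for all $p,t$; and $\gamma=\sum_{v\in V_b\setminus\mathcal{D}(b)}\sum_{t=1}^{T-1}\mathbf{1}[\pi^*(v,t)=\pi^*(v,t+1)]$. -}

module Defs where

open import Data.Nat as ℕ using (ℕ; zero; suc; _+_)
open import Data.Bool using (Bool; true; false; if_then_else_; _∧_; _∨_; not)
open import Data.Fin as Fin using (Fin; toℕ)
open import Data.Fin.Subset using (Subset; _∈_; _∉_; _∪_; _-_; ⁅_⁆; ⊥)
open import Data.Fin.Subset.Properties using (_∈?_)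
open import Data.Sum using (_⊎_)
open import Data.Unit using (⊤)
open import Data.Product using (Σ; _×_; _,_)
open import Relation.Nullary using (¬_)
open import Relation.Nullary.Decidable using (⌊_⌋)
open import Relation.Binary.PropositionalEquality using (_≡_; _≢_)

countF : ∀ {k} → (Fin k → Bool) → ℕ
countF {zero}  f = 0
countF {suc k} f = (if f Fin.zero then 1 else 0) + countF (λ i → f (Fin.suc i))

sumF : ∀ {k} → (Fin k → ℕ) → ℕ
sumF {zero}  f = 0
sumF {suc k} f = f Fin.zero + sumF (λ i → f (Fin.suc i))

-- Temporal graphs.  Vertices are Fin n, time steps [T] = {1..T} are
-- represented by Fin T (time t+1 is represented by the index t).

record TemporalGraph (n T : ℕ) : Set where
  field
    E     : Fin n → Fin n → Bool
    E-sym : ∀ u v → E u v ≡ E v u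
    E-irr : ∀ u → E u u ≡ false
    -- labelling: lab u v t = true  iff  t ∈ λ(uv)  (only for edges uv ∈ E)
    lab     : Fin n → Fin n → Fin T → Bool
    lab-sym : ∀ u v t → lab u v t ≡ lab v u t
    lab-E   : ∀ u v t → lab u v t ≡ true → E u v ≡ true

  Et : Fin T → Fin n → Fin n → Bool
  Et t u v = lab u v t

  deg : Fin n → Fin T → ℕ
  deg u t = countF (λ w → Et t u w)

-- Nice (rooted) tree decompositions, as trees indexed by the bag of
-- their root node.  Leaves have empty bags.

data NTD (n : ℕ) : Subset n → Set where
  leaf      : NTD n ⊥
  introduce : ∀ {B} (v : Fin n) → v ∉ B → NTD n B → NTD n (B ∪ ⁅ v ⁆)
  forget    : ∀ {B} (v : Fin n) → v ∈ B → NTD n B → NTD n (B - v)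
  join      : ∀ {B} → NTD n B → NTD n B → NTD n B

module _ {n : ℕ} where

  bag : ∀ {B} → NTD n B → Subset n
  bag {B} _ = B

  Vb : ∀ {B} → NTD n B → Subset n
  Vb leaf              = ⊥
  Vb (introduce {B} v _ t) = (B ∪ ⁅ v ⁆) ∪ Vb t
  Vb (forget {B} v _ t)    = (B - v) ∪ Vb t
  Vb (join {B} l r)        = B ∪ (Vb l ∪ Vb r)

  AnyBag : (Subset n → Set) → ∀ {B} → NTD n B → Set
  AnyBag P {B} leaf              = P B
  AnyBag P {B} (introduce v _ t) = P B ⊎ AnyBag P t
  AnyBag P {B} (forget v _ t)    = P B ⊎ AnyBag P t
  AnyBag P {B} (join l r)        = P B ⊎ (AnyBag P l ⊎ AnyBag P r)

  -- The nodes of the tree whose bags contain u induce a connected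
  -- subgraph of the tree (possibly empty).
  ConnectedOcc : Fin n → ∀ {B} → NTD n B → Set
  ConnectedOcc u leaf = ⊤
  ConnectedOcc u {B} (introduce v _ t) =
    ConnectedOcc u t × (u ∈ B → u ∈ Vb t → u ∈ bag t)
  ConnectedOcc u {B} (forget v _ t) =
    ConnectedOcc u t × (u ∈ B → u ∈ Vb t → u ∈ bag t)
  ConnectedOcc u {B} (join l r) =
    ConnectedOcc u l × ConnectedOcc u r ×
    (u ∈ B → (u ∈ Vb l → u ∈ bag l) × (u ∈ Vb r → u ∈ bag r)) ×
    (u ∉ B → ¬ (u ∈ Vb l × u ∈ Vb r))

  data SubtreeOf {B₀} (s : NTD n B₀) : ∀ {B} → NTD n B → Set where
    here      : SubtreeOf s s
    under-introduce : ∀ {B} {v} {p : v ∉ B} {t : NTD n B} →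
                      SubtreeOf s t → SubtreeOf s (introduce v p t)
    under-forget    : ∀ {B} {v} {p : v ∈ B} {t : NTD n B} →
                      SubtreeOf s t → SubtreeOf s (forget v p t)
    under-joinˡ     : ∀ {B} {l r : NTD n B} → SubtreeOf s l → SubtreeOf s (join l r)
    under-joinʳ     : ∀ {B} {l r : NTD n B} → SubtreeOf s r → SubtreeOf s (join l r)

-- (H, D) is a nice tree decomposition of the underlying graph of 𝒢:
-- the root has an empty bag (built into the type NTD n ⊥), and
module _ {n T : ℕ} (𝒢 : TemporalGraph n T) where
  open TemporalGraph 𝒢

  record IsNiceTreeDecomposition (τ : NTD n ⊥) : Set where
    field
      vertex-covered : ∀ u → u ∈ Vb τ
      edge-covered   : ∀ u v → E u v ≡ true → AnyBag (λ D → u ∈ D × v ∈ D) τ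
      connected      : ∀ u → ConnectedOcc u τ

-- States.  π is a total function; only its values on D(b) × [T] matter
--.

record State (n T c : ℕ) : Set where
  constructor state
  field
    π : Fin n → Fin T → Fin c
    α : Fin c → ℕ
    β : Fin c → Fin T → ℕ
    γ : ℕ

module _ {n T : ℕ} (𝒢 : TemporalGraph n T) {c : ℕ} where
  open TemporalGraph 𝒢

  _∈ᵇ_ : Fin n → Subset n → Bool
  u ∈ᵇ S = ⌊ u ∈? S ⌋

  _=ᶜ_ : Fin c → Fin c → Bool
  p =ᶜ q = ⌊ p Fin.≟ q ⌋

  forgottenᵇ : ∀ {B} → NTD n B → Fin n → Bool
  forgottenᵇ {B} t u = (u ∈ᵇ Vb t) ∧ not (u ∈ᵇ B)

  -- α-count: pairs (uv, t) with uv ∈ E_t (uv unordered, counted once via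
  -- toℕ u < toℕ v), u, v ∈ V_b, both coloured p, and an endpoint forgotten
  alphaCount : ∀ {B} → NTD n B → (Fin n → Fin T → Fin c) → Fin c → ℕ
  alphaCount t π* p =
    sumF λ u → sumF λ v → countF λ s →
      ⌊ toℕ u ℕ.<? toℕ v ⌋ ∧ Et s u v ∧ (u ∈ᵇ Vb t) ∧ (v ∈ᵇ Vb t) ∧
      (π* u s =ᶜ p) ∧ (π* v s =ᶜ p) ∧ (forgottenᵇ t u ∨ forgottenᵇ t v)

  betaSum : ∀ {B} → NTD n B → (Fin n → Fin T → Fin c) → Fin c → Fin T → ℕ
  betaSum t π* p s =
    sumF λ u → if forgottenᵇ t u ∧ (π* u s =ᶜ p) then deg u s else 0

  sameConsec : (Fin T → Fin c) → ℕ
  sameConsec f = sumF λ s → countF λ s' →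
    ⌊ toℕ s' ℕ.≟ suc (toℕ s) ⌋ ∧ (f s =ᶜ f s')

  gammaSum : ∀ {B} → NTD n B → (Fin n → Fin T → Fin c) → ℕ
  gammaSum t π* = sumF λ u → if forgottenᵇ t u then sameConsec (π* u) else 0

  Supports : ∀ {B} → NTD n B → State n T c → (Fin n → Fin T → Fin c) → Set
  Supports {B} t st π* =
    (∀ u → u ∈ B → ∀ s → π* u s ≡ State.π st u s) ×
    (∀ p → State.α st p ≡ alphaCount t π* p) ×
    (∀ p s → State.β st p s ≡ betaSum t π* p s) ×
    (State.γ st ≡ gammaSum t π*)

  Valid : ∀ {B} → NTD n B → State n T c → Set
  Valid t st = Σ (Fin n → Fin T → Fin c) (Supports t st)

  newAlpha : Subset n → Fin n → (Fin n → Fin T → Fin c) → Fin c → ℕ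
  newAlpha D v π' p = sumF λ u → countF λ s →
    (u ∈ᵇ D) ∧ Et s u v ∧ (π' u s =ᶜ p) ∧ (π' v s =ᶜ p)

  ForgetRel : Subset n → Fin n → State n T c → State n T c → Set
  ForgetRel D v st st' =
    (∀ u → u ∈ D → ∀ s → State.π st u s ≡ State.π st' u s) ×
    (∀ p → State.α st p ≡ State.α st' p + newAlpha D v (State.π st') p) ×
    (∀ p s → (State.π st' v s ≡ p → State.β st p s ≡ State.β st' p s + deg v s) ×
             (State.π st' v s ≢ p → State.β st p s ≡ State.β st' p s)) ×
    (State.γ st ≡ State.γ st' + sameConsec (State.π st' v))

-- Forgetting v splits each of α, β and γ into the part already counted at
-- the child b' and a part contributed by v alone.  For β and γ this holds
-- because the vertices forgotten at b are those forgotten at b' together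
-- with v.  For α, an edge uw with both ends in V_b is newly counted exactly
-- when neither end is forgotten at b' but one end is v; the other end then
-- lies in the bag, so counting such edges once per unordered pair amounts to
-- counting the vertices u ∈ D(b) adjacent to v.  Hence a colouring supporting
-- a state of b supports the state it induces at b', and conversely.
module Submission where

open import Defs
open import Data.Nat using (ℕ; _≤_)
open import Data.Fin using (Fin)
open import Data.Fin.Subset using (Subset; _∈_; _-_; ⊥)
open import Data.Product using (Σ; _×_)
open import Function.Bundles using (_⇔_)

import Data.Nat as ℕ
open import Data.Nat using (zero; suc; _+_; _<?_)
open import Data.Nat.Properties using (+-identityʳ; +-0-commutativeMonoid; n≮n)
open import Data.Bool using (Bool; true; false; if_then_else_; _∧_; _∨_; not)
open import Data.Bool.Properties
  using (∧-comm; ∧-assoc; ∧-identityʳ; ∧-zeroʳ; if-∧; if-cong)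
open import Data.Bool.Solver using (module ∨-∧-Solver)
import Data.Fin as Fin
open import Data.Fin using (toℕ; _≟_)
open import Data.Fin.Properties using (<-cmp; suc-injective)
open import Data.Fin.Subset using (_∉_; _⊆_; _─_; ⁅_⁆)
open import Data.Fin.Subset.Properties
  using (_∈?_; x∈⁅x⁆; x∈p∪q⁻; x∈p∪q⁺; ∉⊥; p─q⊆p; x∈p∧x≢y⇒x∈p-y)
open import Data.Vec.Base using (_∷_; here; there)
open import Data.Sum using (_⊎_; inj₁; inj₂; [_,_])
open import Data.Product using (_,_)
open import Function.Base using (_∘_; id)
open import Function.Bundles using (mk⇔; Equivalence)
open import Relation.Binary.Definitions using (tri<; tri≈; tri>)
open import Relation.Nullary using (Dec; yes; no; ¬_; contradiction)
open import Relation.Nullary.Decidable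
  using (⌊_⌋; isYes≗does; dec-true; dec-false; does-⇔)
open import Relation.Binary.PropositionalEquality
  using (_≡_; _≢_; refl; sym; trans; cong; cong₂; module ≡-Reasoning)
open ≡-Reasoning
open import Algebra.Properties.CommutativeMonoid.Sum +-0-commutativeMonoid
  using (sum; sum-cong-≗; sum-replicate-zero; ∑-distrib-+)

⌊⌋-true : ∀ {ℓ} {A : Set ℓ} (d : Dec A) → A → ⌊ d ⌋ ≡ true
⌊⌋-true d x = trans (isYes≗does d) (dec-true d x)

⌊⌋-false : ∀ {ℓ} {A : Set ℓ} (d : Dec A) → ¬ A → ⌊ d ⌋ ≡ false
⌊⌋-false d ¬x = trans (isYes≗does d) (dec-false d ¬x)

⌊⌋-⇔ : ∀ {ℓ ℓ'} {A : Set ℓ} {B : Set ℓ'} → A ⇔ B → (d : Dec A) (e : Dec B) → ⌊ d ⌋ ≡ ⌊ e ⌋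
⌊⌋-⇔ A⇔B d e = trans (isYes≗does d) (trans (does-⇔ A⇔B d e) (sym (isYes≗does e)))

_≡ᵇ_ : ∀ {k} → Fin k → Fin k → Bool
i ≡ᵇ j = ⌊ i ≟ j ⌋

_≺_ : ∀ {k} → Fin k → Fin k → Bool
u ≺ w = ⌊ toℕ u <? toℕ w ⌋

≺-irrefl : ∀ {k} (u : Fin k) → u ≺ u ≡ false
≺-irrefl u = ⌊⌋-false (toℕ u <? toℕ u) (n≮n (toℕ u))

≺-dichotomy : ∀ {k} {u w : Fin k} → u ≢ w →
  (u ≺ w ≡ true × w ≺ u ≡ false) ⊎ (u ≺ w ≡ false × w ≺ u ≡ true)
≺-dichotomy {u = u} {w} u≢w with <-cmp u w
... | tri< u<w _ w≮u = inj₁ (⌊⌋-true (toℕ u <? toℕ w) u<w , ⌊⌋-false (toℕ w <? toℕ u) w≮u)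
... | tri≈ _ u≡w _   = contradiction u≡w u≢w
... | tri> u≮w _ w<u = inj₂ (⌊⌋-false (toℕ u <? toℕ w) u≮w , ⌊⌋-true (toℕ w <? toℕ u) w<u)

sumF≡sum : ∀ {k} (f : Fin k → ℕ) → sumF f ≡ sum f
sumF≡sum {zero}  f = refl
sumF≡sum {suc k} f = cong (f Fin.zero +_) (sumF≡sum (f ∘ Fin.suc))

sumF-cong : ∀ {k} {f g : Fin k → ℕ} → (∀ i → f i ≡ g i) → sumF f ≡ sumF g
sumF-cong {f = f} {g} f≗g = trans (sumF≡sum f) (trans (sum-cong-≗ f≗g) (sym (sumF≡sum g)))

sumF-zero : ∀ k → sumF {k} (λ _ → 0) ≡ 0
sumF-zero k = trans (sumF≡sum {k} _) (sum-replicate-zero k)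

sumF-+ : ∀ {k} (f g : Fin k → ℕ) → sumF (λ i → f i + g i) ≡ sumF f + sumF g
sumF-+ {k} f g =
  trans (sumF≡sum {k} _) (trans (∑-distrib-+ f g) (sym (cong₂ _+_ (sumF≡sum f) (sumF≡sum g))))

sumF-concentrated : ∀ {k} (f : Fin k → ℕ) (j : Fin k) →
  (∀ i → i ≢ j → f i ≡ 0) → sumF f ≡ f j
sumF-concentrated {suc k} f Fin.zero off = begin
  f Fin.zero + sumF (f ∘ Fin.suc)  ≡⟨ cong (f Fin.zero +_) rest-vanishes ⟩
  f Fin.zero + 0                   ≡⟨ +-identityʳ _ ⟩
  f Fin.zero                       ∎
  where
  rest-vanishes : sumF (f ∘ Fin.suc) ≡ 0
  rest-vanishes = trans (sumF-cong (λ i → off (Fin.suc i) λ ())) (sumF-zero k)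
sumF-concentrated f (Fin.suc j) off = begin
  f Fin.zero + sumF (f ∘ Fin.suc)  ≡⟨ cong (_+ sumF (f ∘ Fin.suc)) (off Fin.zero λ ()) ⟩
  sumF (f ∘ Fin.suc)               ≡⟨ sumF-concentrated (f ∘ Fin.suc) j
                                        (λ i i≢j → off (Fin.suc i) (i≢j ∘ suc-injective)) ⟩
  f (Fin.suc j)                    ∎

sumF-δ : ∀ {k} (f : Fin k → ℕ) (j : Fin k) →
  sumF (λ i → if i ≡ᵇ j then f i else 0) ≡ f j
sumF-δ f j =
  trans (sumF-concentrated _ j (λ i i≢j → if-cong (⌊⌋-false (i ≟ j) i≢j)))
        (if-cong (⌊⌋-true (j ≟ j) refl))

sumF-if : ∀ {k} b (f : Fin k → ℕ) → sumF (λ i → if b then f i else 0) ≡ (if b then sumF f else 0)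
sumF-if true  f = refl
sumF-if {k} false f = sumF-zero k

countF≡sumF : ∀ {k} (f : Fin k → Bool) → countF f ≡ sumF (λ i → if f i then 1 else 0)
countF≡sumF {zero}  f = refl
countF≡sumF {suc k} f = cong ((if f Fin.zero then 1 else 0) +_) (countF≡sumF (f ∘ Fin.suc))

countF-cong : ∀ {k} {f g : Fin k → Bool} → (∀ i → f i ≡ g i) → countF f ≡ countF g
countF-cong {f = f} {g} f≗g =
  trans (countF≡sumF f) (trans (sumF-cong (λ i → if-cong (f≗g i))) (sym (countF≡sumF g)))

countF-∧ˡ : ∀ {k} b (f : Fin k → Bool) → countF (λ i → b ∧ f i) ≡ (if b then countF f else 0)
countF-∧ˡ true  f = refl
countF-∧ˡ {k} false f = trans (countF≡sumF {k} _) (sumF-zero k)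

-- The terms with u = v and those with w = v are disjoint since ≺ is irreflexive;
-- together they meet each u ≠ v exactly once, as (u, v) or as (v, u).
sumF-pairs-through : ∀ {k} (h : Fin k → Fin k → ℕ) → (∀ u w → h u w ≡ h w u) → (v : Fin k) →
  sumF (λ u → sumF (λ w → if u ≺ w ∧ (u ≡ᵇ v ∨ w ≡ᵇ v) then h u w else 0))
  ≡ sumF (λ u → if u ≡ᵇ v then 0 else h u v)
sumF-pairs-through {k} h h-sym v = begin
  sumF (λ u → sumF (λ w → if u ≺ w ∧ (u ≡ᵇ v ∨ w ≡ᵇ v) then h u w else 0))
    ≡⟨ sumF-cong (λ u → trans (sumF-cong (split u)) (sumF-+ {k} _ _)) ⟩
  sumF (λ u → sumF (λ w → if w ≡ᵇ v then below u else 0)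
            + sumF (λ w → if u ≡ᵇ v then above w else 0))
    ≡⟨ sumF-cong (λ u → cong₂ _+_ (sumF-δ (λ _ → below u) v) (sumF-if (u ≡ᵇ v) above)) ⟩
  sumF (λ u → below u + (if u ≡ᵇ v then sumF above else 0))
    ≡⟨ sumF-+ below _ ⟩
  sumF below + sumF (λ u → if u ≡ᵇ v then sumF above else 0)
    ≡⟨ cong (sumF below +_) (sumF-δ (λ _ → sumF above) v) ⟩
  sumF below + sumF above
    ≡⟨ sumF-+ below above ⟨
  sumF (λ u → below u + above u)
    ≡⟨ sumF-cong other-end ⟩
  sumF (λ u → if u ≡ᵇ v then 0 else h u v)
    ∎
  where
  below above : Fin k → ℕ
  below u = if u ≺ v then h u v else 0
  above w = if v ≺ w then h v w else 0

  split : ∀ u w → (if u ≺ w ∧ (u ≡ᵇ v ∨ w ≡ᵇ v) then h u w else 0)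
                ≡ (if w ≡ᵇ v then below u else 0) + (if u ≡ᵇ v then above w else 0)
  split u w with u ≟ v | w ≟ v
  ... | yes refl | yes refl rewrite ≺-irrefl v = refl
  ... | yes refl | no _  = if-cong (∧-identityʳ (v ≺ w))
  ... | no _     | yes refl = trans (if-cong (∧-identityʳ (u ≺ v))) (sym (+-identityʳ _))
  ... | no _     | no _  = if-cong (∧-zeroʳ (u ≺ w))

  other-end : ∀ u → below u + above u ≡ (if u ≡ᵇ v then 0 else h u v)
  other-end u with u ≟ v
  ... | yes refl rewrite ≺-irrefl v = refl
  ... | no u≢v with ≺-dichotomy u≢v
  ...   | inj₁ (u≺v , v⊀u) rewrite u≺v | v⊀u = +-identityʳ _
  ...   | inj₂ (u⊀v , v≺u) rewrite u⊀v | v≺u = h-sym v u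

record DisjointOr (c a b : Bool) : Set where
  constructor disjointOr
  field
    is-or    : c ≡ a ∨ b
    disjoint : a ∧ b ≡ false

if-DisjointOr : ∀ {a b c} (m : ℕ) → DisjointOr c a b →
  (if c then m else 0) ≡ (if a then m else 0) + (if b then m else 0)
if-DisjointOr {true}  {true}  m (disjointOr _ ())
if-DisjointOr {true}  {false} m (disjointOr refl _) = sym (+-identityʳ m)
if-DisjointOr {false} {true}  m (disjointOr refl _) = refl
if-DisjointOr {false} {false} m (disjointOr refl _) = refl

DisjointOr-∧ˡ : ∀ l {a b c} → DisjointOr c a b → DisjointOr (l ∧ c) (l ∧ a) (l ∧ b)
DisjointOr-∧ˡ true  d = d
DisjointOr-∧ˡ false _ = disjointOr refl refl

≡+if⇔ : ∀ {k} {q p : Fin k} {x y d : ℕ} →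
  (x ≡ y + (if q ≡ᵇ p then d else 0)) ⇔ ((q ≡ p → x ≡ y + d) × (q ≢ p → x ≡ y))
≡+if⇔ {q = q} {p} {y = y} with q ≟ p
... | yes q≡p = mk⇔ (λ e → (λ _ → e) , λ q≢p → contradiction q≡p q≢p)
                    (λ (inc , _) → inc q≡p)
... | no q≢p  = mk⇔ (λ e → (λ q≡p → contradiction q≡p q≢p) , λ _ → trans e (+-identityʳ y))
                    (λ (_ , same) → trans (same q≢p) (sym (+-identityʳ y)))

x∈p─q⇒x∉q : ∀ {n} (p q : Subset n) {x} → x ∈ p ─ q → x ∉ q
x∈p─q⇒x∉q (_ ∷ p) (true ∷ q) () here
x∈p─q⇒x∉q (_ ∷ p) (_ ∷ q) (there x∈p─q) (there x∈q) = x∈p─q⇒x∉q p q x∈p─q x∈q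

bag⊆Vb : ∀ {n B} (t : NTD n B) → B ⊆ Vb t
bag⊆Vb leaf              x∈⊥ = contradiction x∈⊥ ∉⊥
bag⊆Vb (introduce _ _ _) x∈B = x∈p∪q⁺ (inj₁ x∈B)
bag⊆Vb (forget _ _ _)    x∈B = x∈p∪q⁺ (inj₁ x∈B)
bag⊆Vb (join _ _)        x∈B = x∈p∪q⁺ (inj₁ x∈B)

Vb-forget : ∀ {n B} (v : Fin n) (v∈B : v ∈ B) (t : NTD n B) {u} →
  u ∈ Vb (forget v v∈B t) ⇔ u ∈ Vb t
Vb-forget {B = B} v _ t = mk⇔
  (λ u∈Vb → [ (λ u∈D → bag⊆Vb t (p─q⊆p B ⁅ v ⁆ u∈D)) , id ] (x∈p∪q⁻ (B - v) (Vb t) u∈Vb))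
  (λ u∈Vb → x∈p∪q⁺ (inj₂ u∈Vb))

module _ {n T : ℕ} (𝒢 : TemporalGraph n T) {c : ℕ} where
  open TemporalGraph 𝒢

  touching : ∀ {B} → NTD n B → Fin n → Fin n → Bool
  touching t u w =
    ⌊ u ∈? Vb t ⌋ ∧ ⌊ w ∈? Vb t ⌋ ∧ (forgottenᵇ 𝒢 {c} t u ∨ forgottenᵇ 𝒢 {c} t w)

  monoEdgeTimes : (Fin n → Fin T → Fin c) → Fin c → Fin n → Fin n → ℕ
  monoEdgeTimes π p u w = countF λ s → Et s u w ∧ π u s ≡ᵇ p ∧ π w s ≡ᵇ p

  monoEdgeTimes-sym : ∀ π p u w → monoEdgeTimes π p u w ≡ monoEdgeTimes π p w u
  monoEdgeTimes-sym π p u w =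
    countF-cong λ s → cong₂ _∧_ (lab-sym u w s) (∧-comm (π u s ≡ᵇ p) (π w s ≡ᵇ p))

  alphaCount-touching : ∀ {B} (t : NTD n B) π p →
    alphaCount 𝒢 t π p
    ≡ sumF λ u → sumF λ w → if u ≺ w ∧ touching t u w then monoEdgeTimes π p u w else 0
  alphaCount-touching t π p =
    sumF-cong λ u → sumF-cong λ w →
      trans (countF-cong (separate u w)) (countF-∧ˡ {T} (u ≺ w ∧ touching t u w) _)
    where
    open ∨-∧-Solver
    regroup : ∀ l e x y a b f → l ∧ e ∧ x ∧ y ∧ a ∧ b ∧ f ≡ (l ∧ x ∧ y ∧ f) ∧ e ∧ a ∧ b
    regroup = solve 7 (λ l e x y a b f → l :* (e :* (x :* (y :* (a :* (b :* f)))))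
                                       := (l :* (x :* (y :* f))) :* (e :* (a :* b))) refl

    separate : ∀ u w s →
      u ≺ w ∧ Et s u w ∧ ⌊ u ∈? Vb t ⌋ ∧ ⌊ w ∈? Vb t ⌋ ∧ π u s ≡ᵇ p ∧ π w s ≡ᵇ p ∧
        (forgottenᵇ 𝒢 {c} t u ∨ forgottenᵇ 𝒢 {c} t w)
      ≡ (u ≺ w ∧ touching t u w) ∧ Et s u w ∧ π u s ≡ᵇ p ∧ π w s ≡ᵇ p
    separate u w s = regroup (u ≺ w) (Et s u w) ⌊ u ∈? Vb t ⌋ ⌊ w ∈? Vb t ⌋
                             (π u s ≡ᵇ p) (π w s ≡ᵇ p) (forgottenᵇ 𝒢 {c} t u ∨ forgottenᵇ 𝒢 {c} t w)

  induced : ∀ {B} → NTD n B → (Fin n → Fin T → Fin c) → State n T c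
  induced t π = state π (alphaCount 𝒢 t π) (betaSum 𝒢 t π) (gammaSum 𝒢 t π)

  induced-supports : ∀ {B} (t : NTD n B) π → Supports 𝒢 t (induced t π) π
  induced-supports t π = (λ _ _ _ → refl) , (λ _ → refl) , (λ _ _ → refl) , refl

  newAlpha-cong : ∀ {D v} {π₁ π₂ : Fin n → Fin T → Fin c} p →
    (∀ u → u ∈ D → ∀ s → π₁ u s ≡ π₂ u s) → (∀ s → π₁ v s ≡ π₂ v s) →
    newAlpha 𝒢 D v π₁ p ≡ newAlpha 𝒢 D v π₂ p
  newAlpha-cong {D} {v} {π₁} {π₂} p on-D at-v = sumF-cong λ u → countF-cong (agree u)
    where
    agree : ∀ u s → ⌊ u ∈? D ⌋ ∧ Et s u v ∧ π₁ u s ≡ᵇ p ∧ π₁ v s ≡ᵇ p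
                  ≡ ⌊ u ∈? D ⌋ ∧ Et s u v ∧ π₂ u s ≡ᵇ p ∧ π₂ v s ≡ᵇ p
    agree u s with u ∈? D
    ... | yes u∈D = cong₂ (λ x y → Et s u v ∧ x ≡ᵇ p ∧ y ≡ᵇ p) (on-D u u∈D s) (at-v s)
    ... | no _    = refl

  sameConsec-cong : ∀ {f g : Fin T → Fin c} → (∀ s → f s ≡ g s) →
    sameConsec 𝒢 f ≡ sameConsec 𝒢 g
  sameConsec-cong f≗g = sumF-cong λ s → countF-cong λ s' →
    cong (⌊ toℕ s' ℕ.≟ suc (toℕ s) ⌋ ∧_) (cong₂ _≡ᵇ_ (f≗g s) (f≗g s'))

-- Position (u ∈ V_b') (u ∈ D(b')) (u = v) of a vertex u relative to a
-- forget node b with child b' and forgotten vertex v.  In these terms u is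
-- forgotten at b' iff V ∧ not I, and at b iff V ∧ not (I ∧ not e).
data Position : Bool → Bool → Bool → Set where
  outside : Position false false false
  below   : Position true  false false
  kept    : Position true  true  false
  removed : Position true  true  true

forgotten-split : ∀ {V I e} → Position V I e →
  DisjointOr (V ∧ not (I ∧ not e)) (V ∧ not I) e
forgotten-split outside = disjointOr refl refl
forgotten-split below   = disjointOr refl refl
forgotten-split kept    = disjointOr refl refl
forgotten-split removed = disjointOr refl refl

touching-split : ∀ {V I e V₂ I₂ e₂} → Position V I e → Position V₂ I₂ e₂ →
  DisjointOr (V ∧ V₂ ∧ (V ∧ not (I ∧ not e) ∨ V₂ ∧ not (I₂ ∧ not e₂)))
             (V ∧ V₂ ∧ (V ∧ not I ∨ V₂ ∧ not I₂))
             ((e ∨ e₂) ∧ (I ∧ I₂))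
touching-split outside outside = disjointOr refl refl
touching-split outside below   = disjointOr refl refl
touching-split outside kept    = disjointOr refl refl
touching-split outside removed = disjointOr refl refl
touching-split below   outside = disjointOr refl refl
touching-split below   below   = disjointOr refl refl
touching-split below   kept    = disjointOr refl refl
touching-split below   removed = disjointOr refl refl
touching-split kept    outside = disjointOr refl refl
touching-split kept    below   = disjointOr refl refl
touching-split kept    kept    = disjointOr refl refl
touching-split kept    removed = disjointOr refl refl
touching-split removed outside = disjointOr refl refl
touching-split removed below   = disjointOr refl refl
touching-split removed kept    = disjointOr refl refl
touching-split removed removed = disjointOr refl refl

module ForgetNode {n T : ℕ} (𝒢 : TemporalGraph n T) {c : ℕ} {B' : Subset n}
                  (v : Fin n) (v∈B' : v ∈ B') (b' : NTD n B') where
  open TemporalGraph 𝒢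

  b : NTD n (B' - v)
  b = forget v v∈B' b'

  D : Subset n
  D = B' - v

  position : ∀ u → Position ⌊ u ∈? Vb b' ⌋ ⌊ u ∈? B' ⌋ (u ≡ᵇ v)
  position u with u ≟ v | u ∈? B' | u ∈? Vb b'
  ... | _        | yes u∈B' | no u∉Vb = contradiction (bag⊆Vb b' u∈B') u∉Vb
  ... | yes refl | no v∉B'  | _       = contradiction v∈B' v∉B'
  ... | yes refl | yes _    | yes _   = removed
  ... | no _     | yes _    | yes _   = kept
  ... | no _     | no _     | yes _   = below
  ... | no _     | no _     | no _    = outside

  v∉D : ⌊ v ∈? D ⌋ ≡ false
  v∉D = ⌊⌋-false (v ∈? D) (λ v∈D → x∈p─q⇒x∉q B' ⁅ v ⁆ v∈D (x∈⁅x⁆ v))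

  ∈D≡∈B' : ∀ {u} → u ≢ v → ⌊ u ∈? D ⌋ ≡ ⌊ u ∈? B' ⌋
  ∈D≡∈B' u≢v = ⌊⌋-⇔ (mk⇔ (p─q⊆p B' ⁅ v ⁆) (λ u∈B' → x∈p∧x≢y⇒x∈p-y u∈B' u≢v)) _ _

  ∈D : ∀ u → ⌊ u ∈? D ⌋ ≡ ⌊ u ∈? B' ⌋ ∧ not (u ≡ᵇ v)
  ∈D u with u ≟ v
  ... | yes refl = trans v∉D (sym (∧-zeroʳ _))
  ... | no u≢v   = trans (∈D≡∈B' u≢v) (sym (∧-identityʳ _))

  ∈Vb : ∀ u → ⌊ u ∈? Vb b ⌋ ≡ ⌊ u ∈? Vb b' ⌋
  ∈Vb u = ⌊⌋-⇔ (Vb-forget v v∈B' b') _ _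

  forgotten-forget : ∀ u →
    DisjointOr (forgottenᵇ 𝒢 {c} b u) (forgottenᵇ 𝒢 {c} b' u) (u ≡ᵇ v)
  forgotten-forget u rewrite ∈Vb u | ∈D u = forgotten-split (position u)

  touching-forget : ∀ u w →
    DisjointOr (touching 𝒢 {c} b u w) (touching 𝒢 {c} b' u w)
               ((u ≡ᵇ v ∨ w ≡ᵇ v) ∧ (⌊ u ∈? B' ⌋ ∧ ⌊ w ∈? B' ⌋))
  touching-forget u w rewrite ∈Vb u | ∈Vb w | ∈D u | ∈D w =
    touching-split (position u) (position w)

  forgotten-sum : ∀ (x : Fin n → ℕ) →
    sumF (λ u → if forgottenᵇ 𝒢 {c} b u then x u else 0)
    ≡ sumF (λ u → if forgottenᵇ 𝒢 {c} b' u then x u else 0) + x v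
  forgotten-sum x = begin
    sumF (λ u → if forgottenᵇ 𝒢 {c} b u then x u else 0)
      ≡⟨ sumF-cong (λ u → if-DisjointOr (x u) (forgotten-forget u)) ⟩
    sumF (λ u → (if forgottenᵇ 𝒢 {c} b' u then x u else 0) + (if u ≡ᵇ v then x u else 0))
      ≡⟨ sumF-+ {n} _ _ ⟩
    sumF (λ u → if forgottenᵇ 𝒢 {c} b' u then x u else 0) + sumF (λ u → if u ≡ᵇ v then x u else 0)
      ≡⟨ cong (sumF (λ u → if forgottenᵇ 𝒢 {c} b' u then x u else 0) +_) (sumF-δ x v) ⟩
    sumF (λ u → if forgottenᵇ 𝒢 {c} b' u then x u else 0) + x v
      ∎

  betaSum-forget : ∀ (π : Fin n → Fin T → Fin c) p s →
    betaSum 𝒢 b π p s ≡ betaSum 𝒢 b' π p s + (if π v s ≡ᵇ p then deg v s else 0)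
  betaSum-forget π p s = begin
    betaSum 𝒢 b π p s
      ≡⟨ sumF-cong (λ u → if-∧ (forgottenᵇ 𝒢 {c} b u)) ⟩
    sumF (λ u → if forgottenᵇ 𝒢 {c} b u then coloured-deg u else 0)
      ≡⟨ forgotten-sum coloured-deg ⟩
    sumF (λ u → if forgottenᵇ 𝒢 {c} b' u then coloured-deg u else 0) + coloured-deg v
      ≡⟨ cong (_+ coloured-deg v) (sumF-cong (λ u → if-∧ (forgottenᵇ 𝒢 {c} b' u))) ⟨
    betaSum 𝒢 b' π p s + coloured-deg v
      ∎
    where
    coloured-deg : Fin n → ℕ
    coloured-deg u = if π u s ≡ᵇ p then deg u s else 0

  gammaSum-forget : ∀ (π : Fin n → Fin T → Fin c) →
    gammaSum 𝒢 b π ≡ gammaSum 𝒢 b' π + sameConsec 𝒢 (π v)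
  gammaSum-forget π = forgotten-sum (λ u → sameConsec 𝒢 (π u))

  alphaCount-forget : ∀ (π : Fin n → Fin T → Fin c) p →
    alphaCount 𝒢 b π p ≡ alphaCount 𝒢 b' π p + newAlpha 𝒢 D v π p
  alphaCount-forget π p = begin
    alphaCount 𝒢 b π p
      ≡⟨ alphaCount-touching 𝒢 {c} b π p ⟩
    sumF (λ u → sumF λ w → if u ≺ w ∧ touching 𝒢 {c} b u w then m u w else 0)
      ≡⟨ sumF-cong (λ u → trans (sumF-cong (λ w → if-DisjointOr (m u w)
                                    (DisjointOr-∧ˡ (u ≺ w) (touching-forget u w))))
                                 (sumF-+ {n} _ _)) ⟩
    sumF (λ u → sumF (λ w → if u ≺ w ∧ touching 𝒢 {c} b' u w then m u w else 0)
              + sumF (λ w → if u ≺ w ∧ through u w then m u w else 0))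
      ≡⟨ sumF-+ {n} _ _ ⟩
    sumF (λ u → sumF λ w → if u ≺ w ∧ touching 𝒢 {c} b' u w then m u w else 0)
    + sumF (λ u → sumF λ w → if u ≺ w ∧ through u w then m u w else 0)
      ≡⟨ cong₂ _+_ (sym (alphaCount-touching 𝒢 {c} b' π p)) new-edges ⟩
    alphaCount 𝒢 b' π p + newAlpha 𝒢 D v π p
      ∎
    where
    m : Fin n → Fin n → ℕ
    m = monoEdgeTimes 𝒢 π p

    through : Fin n → Fin n → Bool
    through u w = (u ≡ᵇ v ∨ w ≡ᵇ v) ∧ (⌊ u ∈? B' ⌋ ∧ ⌊ w ∈? B' ⌋)

    m-in-bag : Fin n → Fin n → ℕ
    m-in-bag u w = if ⌊ u ∈? B' ⌋ ∧ ⌊ w ∈? B' ⌋ then m u w else 0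

    m-in-bag-sym : ∀ u w → m-in-bag u w ≡ m-in-bag w u
    m-in-bag-sym u w = trans (if-cong (∧-comm ⌊ u ∈? B' ⌋ ⌊ w ∈? B' ⌋))
                             (cong (λ x → if ⌊ w ∈? B' ⌋ ∧ ⌊ u ∈? B' ⌋ then x else 0)
                                   (monoEdgeTimes-sym 𝒢 π p u w))

    regroup : ∀ u w → (if u ≺ w ∧ through u w then m u w else 0)
                    ≡ (if u ≺ w ∧ (u ≡ᵇ v ∨ w ≡ᵇ v) then m-in-bag u w else 0)
    regroup u w = trans (if-cong (sym (∧-assoc (u ≺ w) (u ≡ᵇ v ∨ w ≡ᵇ v) _)))
                        (if-∧ (u ≺ w ∧ (u ≡ᵇ v ∨ w ≡ᵇ v)))

    bag-neighbour : ∀ u → (if u ≡ᵇ v then 0 else m-in-bag u v) ≡ (if ⌊ u ∈? D ⌋ then m u v else 0)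
    bag-neighbour u with u ≟ v
    ... | yes refl rewrite v∉D = refl
    ... | no u≢v rewrite ∈D≡∈B' u≢v | ⌊⌋-true (v ∈? B') v∈B' = if-cong (∧-identityʳ ⌊ u ∈? B' ⌋)

    new-edges : sumF (λ u → sumF λ w → if u ≺ w ∧ through u w then m u w else 0)
              ≡ newAlpha 𝒢 D v π p
    new-edges = begin
      sumF (λ u → sumF λ w → if u ≺ w ∧ through u w then m u w else 0)
        ≡⟨ sumF-cong (λ u → sumF-cong (regroup u)) ⟩
      sumF (λ u → sumF λ w → if u ≺ w ∧ (u ≡ᵇ v ∨ w ≡ᵇ v) then m-in-bag u w else 0)
        ≡⟨ sumF-pairs-through m-in-bag m-in-bag-sym v ⟩
      sumF (λ u → if u ≡ᵇ v then 0 else m-in-bag u v)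
        ≡⟨ sumF-cong (λ u → trans (bag-neighbour u) (sym (countF-∧ˡ {T} ⌊ u ∈? D ⌋ _))) ⟩
      newAlpha 𝒢 D v π p
        ∎

  Related : State n T c → Set
  Related st = Σ (State n T c) (λ st' → Valid 𝒢 b' st' × ForgetRel 𝒢 D v st st')

  valid⇒related : ∀ st → Valid 𝒢 b st → Related st
  valid⇒related st (π , on-bag , α-eq , β-eq , γ-eq) =
    induced 𝒢 b' π , (π , induced-supports 𝒢 b' π) ,
    (λ u u∈D s → sym (on-bag u u∈D s)) ,
    (λ p → trans (α-eq p) (alphaCount-forget π p)) ,
    (λ p s → Equivalence.to ≡+if⇔ (trans (β-eq p s) (betaSum-forget π p s))) ,
    trans γ-eq (gammaSum-forget π)

  related⇒valid : ∀ st → Related st → Valid 𝒢 b st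
  related⇒valid st (st' , (π , on-bag' , α'-eq , β'-eq , γ'-eq) , same-π , α-eq , β-eq , γ-eq) =
    π , on-bag , α-supported , β-supported , γ-supported
    where
    open State using (α; β; γ)
    π-on-B' : ∀ u → u ∈ B' → ∀ s → State.π st' u s ≡ π u s
    π-on-B' u u∈B' s = sym (on-bag' u u∈B' s)

    on-bag : ∀ u → u ∈ D → ∀ s → π u s ≡ State.π st u s
    on-bag u u∈D s = trans (on-bag' u (p─q⊆p B' ⁅ v ⁆ u∈D) s) (sym (same-π u u∈D s))

    α-supported : ∀ p → α st p ≡ alphaCount 𝒢 b π p
    α-supported p = begin
      α st p
        ≡⟨ α-eq p ⟩
      α st' p + newAlpha 𝒢 D v (State.π st') p
        ≡⟨ cong₂ _+_ (α'-eq p) (newAlpha-cong 𝒢 p (λ u u∈D → π-on-B' u (p─q⊆p B' ⁅ v ⁆ u∈D))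
                                                  (π-on-B' v v∈B')) ⟩
      alphaCount 𝒢 b' π p + newAlpha 𝒢 D v π p
        ≡⟨ alphaCount-forget π p ⟨
      alphaCount 𝒢 b π p
        ∎

    β-supported : ∀ p s → β st p s ≡ betaSum 𝒢 b π p s
    β-supported p s = begin
      β st p s
        ≡⟨ Equivalence.from ≡+if⇔ (β-eq p s) ⟩
      β st' p s + (if State.π st' v s ≡ᵇ p then deg v s else 0)
        ≡⟨ cong₂ _+_ (β'-eq p s) (cong (λ q → if q ≡ᵇ p then deg v s else 0) (π-on-B' v v∈B' s)) ⟩
      betaSum 𝒢 b' π p s + (if π v s ≡ᵇ p then deg v s else 0)
        ≡⟨ betaSum-forget π p s ⟨
      betaSum 𝒢 b π p s
        ∎

    γ-supported : γ st ≡ gammaSum 𝒢 b π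
    γ-supported = begin
      γ st                                   ≡⟨ γ-eq ⟩
      γ st' + sameConsec 𝒢 (State.π st' v)  ≡⟨ cong₂ _+_ γ'-eq (sameConsec-cong 𝒢 (π-on-B' v v∈B')) ⟩
      gammaSum 𝒢 b' π + sameConsec 𝒢 (π v)  ≡⟨ gammaSum-forget π ⟨
      gammaSum 𝒢 b π                         ∎

-- The statement holds at every forget node.
lemma9 : ∀ {n T : ℕ} (𝒢 : TemporalGraph n T) (c : ℕ) → 1 ≤ c →
    (τ : NTD n ⊥) → IsNiceTreeDecomposition 𝒢 τ →
    ∀ {B' : Subset n} (v : Fin n) (v∈B' : v ∈ B') (b' : NTD n B') →
    SubtreeOf (forget v v∈B' b') τ →
    (st : State n T c) →
    Valid 𝒢 (forget v v∈B' b') st ⇔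
      Σ (State n T c) (λ st' → Valid 𝒢 b' st' × ForgetRel 𝒢 (B' - v) v st st')
lemma9 𝒢 c _ _ _ v v∈B' b' _ st = mk⇔ (valid⇒related st) (related⇒valid st)
  where open ForgetNode 𝒢 {c} v v∈B' b'
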